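{- Let $k\ge 1$, $n \ge 1$, and let $\Sigma_k=\{0,1,\ldots,k-1\}$. Let $S \subseteq \{1,\ldots,\lfloor n/2\rfloor\}$. Then the number of words $w \in \Sigma_k^n$ whose set of short border lengths is exactly $S$ equals the number of words $w\in\Sigma_k^n$ such that the set of orders of the even palindromic prefixes of $w$ is exactly $S$. In particular (case $S=\emptyset$), $u_k(n) = v_k(n)$: the number of length-$n$ unbordered words over $\Sigma_k$ equals the number of length-$n$ words over $\Sigma_k$ having no even palindromic prefix.
   Context: A border of a word $w$ is a word $u$ with $0<|u|<|w|$ that is both a prefix and a suffix of $w$; $w$ is unbordered if it has no border. The set of short border lengths of $w$ is $\{1\le i\le |w|/2 : w[1..i] \text{ is a border of } w\}$. A palindrome is a word equal to its reverse; it is even if its length is even, and a palindrome of length $m$ has order $\lfloor m/2\rfloor$. An even palindromic prefix of $w$ is a nonempty prefix of $w$ (possibly $w$ itself) that is a palindrome of even length; thus $w$ has an even palindromic prefix of order $i\ge1$ iff $w[1..2i]$ is a palindrome. $u_k(n)$ is the number of unbordered words in $\Sigma_k^n$ and $v_k(n)$ the number of words in $\Sigma_k^n$ with no even palindromic prefix. -}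

module Defs where

open import Data.Nat using (ℕ; zero; suc; _+_; _∸_; _*_; _/_; _≤_; _≥_)
open import Data.Nat.Properties using (_≟_)
open import Data.Fin using (Fin; toℕ)
open import Data.Fin.Properties using () renaming (_≟_ to _≟ᶠ_)
open import Data.Vec using (Vec; []; _∷_; toList)
open import Data.List using (List; []; _∷_; take; drop; reverse; length; filter; concatMap; map)
open import Data.List.Properties using (≡-dec)
open import Data.Bool using (Bool; true; false; T)
open import Data.Product using (_×_)
open import Relation.Binary.PropositionalEquality using (_≡_)
open import Relation.Unary using (Pred; Decidable)
open import Function.Bundles using (_⇔_)

allWords : (k n : ℕ) → List (Vec (Fin k) n)
allWords k zero = [] ∷ []
allWords k (suc n) =
  concatMap (λ a → map (a ∷_) (allWords k n)) (Data.List.allFin k)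
  where import Data.List

count : (k n : ℕ) {P : Pred (Vec (Fin k) n) Agda.Primitive.lzero} → Decidable P → ℕ
count k n P? = length (filter P? (allWords k n))

-- w[1..i] is a border of w (for 0 < i < |w|): prefix of length i equals suffix of length i.
-- (Used only for 1 ≤ i ≤ n/2, where 0 < i < n holds automatically.)
IsBorderLength : {k n : ℕ} → Vec (Fin k) n → ℕ → Set
IsBorderLength {n = n} w i = take i (toList w) ≡ drop (n ∸ i) (toList w)

Palindrome : {A : Set} → List A → Set
Palindrome xs = xs ≡ reverse xs

HasEvenPalPrefixOfOrder : {k n : ℕ} → Vec (Fin k) n → ℕ → Set
HasEvenPalPrefixOfOrder {n = n} w i = (2 * i ≤ n) × Palindrome (take (2 * i) (toList w))

-- A subset S ⊆ {1,…,⌊n/2⌋}, encoded as its characteristic function: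
-- position j : Fin (n / 2) stands for the element toℕ j + 1.
SubsetHalf : ℕ → Set
SubsetHalf n = Fin (n / 2) → Bool

ShortBordersAre : {k n : ℕ} → SubsetHalf n → Vec (Fin k) n → Set
ShortBordersAre {n = n} S w = (j : Fin (n / 2)) → IsBorderLength w (suc (toℕ j)) ⇔ T (S j)

-- The set of orders of even palindromic prefixes of w is exactly S.
-- (Any order i satisfies 2i ≤ n, i.e. i ≤ ⌊n/2⌋, so ranging over Fin (n / 2) covers all orders.)
EvenPalOrdersAre : {k n : ℕ} → SubsetHalf n → Vec (Fin k) n → Set
EvenPalOrdersAre {n = n} S w = (j : Fin (n / 2)) → HasEvenPalPrefixOfOrder w (suc (toℕ j)) ⇔ T (S j)

module Submission where

-- Reading a word w₁w₂…wₙ alternately from both ends gives the word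
-- w₁wₙw₂wₙ₋₁…, a permutation of its positions. Its prefix of length 2i
-- interleaves w₁…wᵢ with the reversed suffix of length i, and such an
-- interleaving is a palindrome exactly when the prefix and the suffix agree,
-- i.e. when i is a border length of w. So this permutation carries the words
-- whose short border lengths are S onto the words whose even palindromic
-- prefixes have orders S.

open import Defs
open import Data.Nat using (ℕ; zero; suc; _+_; _∸_; _*_; _⊓_; _/_; _≤_; _≥_; s≤s)
open import Data.Nat.Properties
  using (+-suc; suc-injective; ≤-trans; ≤-reflexive; *-comm; *-monoˡ-≤; m≤m+n; m∸[m∸n]≡n; m≤n⇒m⊓n≡m)
open import Data.Nat.DivMod using (m/n*n≤m)
open import Data.Fin using (Fin; toℕ)
open import Data.Fin.Properties using (toℕ<n)
open import Data.Vec using (Vec; []; _∷_; _∷ʳ_; init; last; initLast; toList)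
open import Data.Vec.Properties using (init-∷ʳ; last-∷ʳ; toList-∷ʳ; length-toList; ∷-injectiveˡ; ∷-injectiveʳ)
open import Data.List using (List; []; _∷_; _++_; [_]; take; drop; reverse; length; map; filter; allFin; cartesianProductWith; concatMap)
open import Data.List.Properties
  using (++-assoc; reverse-++; reverse-involutive; length-reverse; length-take; length-drop; take++drop≡id; take-all; filter-≐)
open import Data.List.Membership.Propositional using (_∈_)
open import Data.List.Membership.Propositional.Properties using (∈-map⁺; ∈-allFin; ∈-cartesianProductWith⁺)
open import Data.List.Membership.Propositional.Properties.WithK using (unique∧set⇒bag)
open import Data.List.Relation.Unary.Any using (here)
open import Data.List.Relation.Unary.All using ([])
open import Data.List.Relation.Unary.Unique.Propositional using (Unique; []; _∷_)
import Data.List.Relation.Unary.Unique.Propositional.Properties as Unique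
open import Data.List.Relation.Binary.BagAndSetEquality using (∼bag⇒↭)
open import Data.List.Relation.Binary.Permutation.Propositional using (_↭_)
open import Data.List.Relation.Binary.Permutation.Propositional.Properties using (↭-length; filter-↭)
open import Data.Product using (_,_; proj₂)
open import Relation.Nullary using (yes; no)
open import Level using (0ℓ)
open import Relation.Unary using (Pred; Decidable)
open import Relation.Binary.PropositionalEquality hiding ([_])
open import Function.Base using (_∘_)
open import Function.Bundles using (_⇔_; mk⇔; Equivalence)
open import Function.Construct.Composition using (_⇔-∘_)
open import Function.Construct.Symmetry using (⇔-sym)

open ≡-Reasoning

private variable
  A : Set

interleave : List A → List A → List A
interleave []       _        = []
interleave (_ ∷ _)  []       = []
interleave (x ∷ xs) (y ∷ ys) = x ∷ y ∷ interleave xs ys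

evens : List A → List A
evens []           = []
evens (x ∷ [])     = x ∷ []
evens (x ∷ _ ∷ zs) = x ∷ evens zs

evens-interleave : (xs ys : List A) → length xs ≡ length ys → evens (interleave xs ys) ≡ xs
evens-interleave []       []       _  = refl
evens-interleave (x ∷ xs) (y ∷ ys) eq = cong (x ∷_) (evens-interleave xs ys (suc-injective eq))

interleave-++ : (xs ys : List A) {xs′ ys′ : List A} → length xs ≡ length ys →
                interleave (xs ++ xs′) (ys ++ ys′) ≡ interleave xs ys ++ interleave xs′ ys′
interleave-++ []       []       _  = refl
interleave-++ (x ∷ xs) (y ∷ ys) eq = cong (λ zs → x ∷ y ∷ zs) (interleave-++ xs ys (suc-injective eq))

reverse-interleave : (xs ys : List A) → length xs ≡ length ys →
                     reverse (interleave xs ys) ≡ interleave (reverse ys) (reverse xs)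
reverse-interleave []       []       _  = refl
reverse-interleave (x ∷ xs) (y ∷ ys) eq = begin
  reverse ((x ∷ y ∷ []) ++ interleave xs ys)
    ≡⟨ reverse-++ (x ∷ y ∷ []) (interleave xs ys) ⟩
  reverse (interleave xs ys) ++ interleave [ y ] [ x ]
    ≡⟨ cong (_++ y ∷ x ∷ []) (reverse-interleave xs ys eq′) ⟩
  interleave (reverse ys) (reverse xs) ++ interleave [ y ] [ x ]
    ≡⟨ interleave-++ (reverse ys) (reverse xs) reversed-lengths ⟨
  interleave (reverse ys ++ [ y ]) (reverse xs ++ [ x ])
    ≡⟨ cong₂ interleave (reverse-++ [ y ] ys) (reverse-++ [ x ] xs) ⟨
  interleave (reverse (y ∷ ys)) (reverse (x ∷ xs)) ∎
  where
  eq′ = suc-injective eq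
  reversed-lengths : length (reverse ys) ≡ length (reverse xs)
  reversed-lengths = trans (length-reverse ys) (trans (sym eq′) (sym (length-reverse xs)))

palindrome-interleave-reverse : (xs ys : List A) → length xs ≡ length ys →
                                Palindrome (interleave xs (reverse ys)) ⇔ xs ≡ ys
palindrome-interleave-reverse xs ys eq = mk⇔ to from
  where
  with-reverse : ∀ us vs → length us ≡ length vs → length us ≡ length (reverse vs)
  with-reverse us vs e = trans e (sym (length-reverse vs))

  mirror : ∀ us vs → length us ≡ length vs →
           reverse (interleave us (reverse vs)) ≡ interleave vs (reverse us)
  mirror us vs e = begin
    reverse (interleave us (reverse vs))           ≡⟨ reverse-interleave us (reverse vs) (with-reverse us vs e) ⟩
    interleave (reverse (reverse vs)) (reverse us) ≡⟨ cong (λ zs → interleave zs (reverse us)) (reverse-involutive vs) ⟩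
    interleave vs (reverse us)                     ∎

  to : Palindrome (interleave xs (reverse ys)) → xs ≡ ys
  to pal = begin
    xs                                  ≡⟨ evens-interleave xs (reverse ys) (with-reverse xs ys eq) ⟨
    evens (interleave xs (reverse ys))  ≡⟨ cong evens (trans pal (mirror xs ys eq)) ⟩
    evens (interleave ys (reverse xs))  ≡⟨ evens-interleave ys (reverse xs) (with-reverse ys xs (sym eq)) ⟩
    ys                                  ∎

  from : xs ≡ ys → Palindrome (interleave xs (reverse ys))
  from refl = sym (mirror xs xs refl)

take-interleave : ∀ i (xs ys : List A) → take (2 * i) (interleave xs ys) ≡ interleave (take i xs) (take i ys)
take-interleave zero    xs       ys       = refl
take-interleave (suc i) []       ys       = refl
take-interleave (suc i) (x ∷ xs) []       = refl
take-interleave (suc i) (x ∷ xs) (y ∷ ys) rewrite +-suc i (i + 0) =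
  cong (λ zs → x ∷ y ∷ zs) (take-interleave i xs ys)

take-++ˡ : ∀ m (xs ys : List A) → m ≤ length xs → take m (xs ++ ys) ≡ take m xs
take-++ˡ zero    xs       ys _         = refl
take-++ˡ (suc m) (x ∷ xs) ys (s≤s m≤) = cong (x ∷_) (take-++ˡ m xs ys m≤)

length-drop-∸ : ∀ {n} i (xs : List A) → length xs ≡ n → i ≤ n → length (drop (n ∸ i) xs) ≡ i
length-drop-∸ i xs refl i≤n = trans (length-drop (length xs ∸ i) xs) (m∸[m∸n]≡n i≤n)

take-reverse : ∀ {n} i (xs : List A) → length xs ≡ n → i ≤ n → take i (reverse xs) ≡ reverse (drop (n ∸ i) xs)
take-reverse {n = n} i xs len i≤n = begin
  take i (reverse xs)                                 ≡⟨ cong (take i ∘ reverse) (take++drop≡id m xs) ⟨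
  take i (reverse (take m xs ++ drop m xs))           ≡⟨ cong (take i) (reverse-++ (take m xs) (drop m xs)) ⟩
  take i (reverse (drop m xs) ++ reverse (take m xs)) ≡⟨ take-++ˡ i _ _ (≤-reflexive (sym suffix-length)) ⟩
  take i (reverse (drop m xs))                        ≡⟨ take-all i _ (≤-reflexive suffix-length) ⟩
  reverse (drop m xs)                                 ∎
  where
  m = n ∸ i
  suffix-length : length (reverse (drop m xs)) ≡ i
  suffix-length = trans (length-reverse (drop m xs)) (length-drop-∸ i xs len i≤n)

init-∷ʳ-last : ∀ {n} (xs : Vec A (suc n)) → init xs ∷ʳ last xs ≡ xs
init-∷ʳ-last xs = sym (proj₂ (proj₂ (initLast xs)))

shuffle : ∀ {n} → Vec A n → Vec A n
shuffle {n = zero}        []       = []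
shuffle {n = suc zero}    (a ∷ []) = a ∷ []
shuffle {n = suc (suc n)} (a ∷ xs) = a ∷ last xs ∷ shuffle (init xs)

unshuffle : ∀ {n} → Vec A n → Vec A n
unshuffle []           = []
unshuffle (a ∷ [])     = a ∷ []
unshuffle (a ∷ b ∷ ys) = a ∷ (unshuffle ys ∷ʳ b)

unshuffle-shuffle : ∀ {n} (w : Vec A n) → unshuffle (shuffle w) ≡ w
unshuffle-shuffle {n = zero}        []       = refl
unshuffle-shuffle {n = suc zero}    (a ∷ []) = refl
unshuffle-shuffle {n = suc (suc n)} (a ∷ xs) =
  cong (a ∷_) (trans (cong (_∷ʳ last xs) (unshuffle-shuffle (init xs))) (init-∷ʳ-last xs))

shuffle-unshuffle : ∀ {n} (w : Vec A n) → shuffle (unshuffle w) ≡ w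
shuffle-unshuffle []           = refl
shuffle-unshuffle (a ∷ [])     = refl
shuffle-unshuffle (a ∷ b ∷ ys) =
  cong₂ (λ c zs → a ∷ c ∷ zs) (last-∷ʳ b (unshuffle ys))
        (trans (cong shuffle (init-∷ʳ b (unshuffle ys))) (shuffle-unshuffle ys))

interleave-reverse-∷-∷ʳ : ∀ (a b : A) us →
  interleave (a ∷ us ++ [ b ]) (reverse (a ∷ us ++ [ b ])) ≡ a ∷ b ∷ interleave us (reverse us) ++ b ∷ a ∷ []
interleave-reverse-∷-∷ʳ a b us = begin
  interleave (a ∷ us ++ [ b ]) (reverse ([ a ] ++ us ++ [ b ]))
    ≡⟨ cong (interleave (a ∷ us ++ [ b ])) reverse-ends ⟩
  a ∷ b ∷ interleave (us ++ [ b ]) (reverse us ++ [ a ])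
    ≡⟨ cong (λ zs → a ∷ b ∷ zs) (interleave-++ us (reverse us) (sym (length-reverse us))) ⟩
  a ∷ b ∷ interleave us (reverse us) ++ b ∷ a ∷ [] ∎
  where
  reverse-ends : reverse ([ a ] ++ us ++ [ b ]) ≡ b ∷ reverse us ++ [ a ]
  reverse-ends = begin
    reverse ([ a ] ++ us ++ [ b ])  ≡⟨ reverse-++ [ a ] (us ++ [ b ]) ⟩
    reverse (us ++ [ b ]) ++ [ a ]  ≡⟨ cong (_++ [ a ]) (reverse-++ us [ b ]) ⟩
    b ∷ reverse us ++ [ a ]         ∎

interleave-reverse-toList : ∀ {n} (w : Vec A n) →
  interleave (toList w) (reverse (toList w)) ≡ toList (shuffle w) ++ reverse (toList (shuffle w))
interleave-reverse-toList {n = zero}        []       = refl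
interleave-reverse-toList {n = suc zero}    (a ∷ []) = refl
interleave-reverse-toList {n = suc (suc n)} (a ∷ xs) = begin
  interleave (a ∷ toList xs) (reverse (a ∷ toList xs))
    ≡⟨ cong (λ zs → interleave (a ∷ zs) (reverse (a ∷ zs))) toList-xs ⟩
  interleave (a ∷ us ++ [ b ]) (reverse (a ∷ us ++ [ b ]))
    ≡⟨ interleave-reverse-∷-∷ʳ a b us ⟩
  a ∷ b ∷ interleave us (reverse us) ++ b ∷ a ∷ []
    ≡⟨ cong (λ zs → a ∷ b ∷ zs ++ b ∷ a ∷ []) (interleave-reverse-toList (init xs)) ⟩
  a ∷ b ∷ (s ++ reverse s) ++ b ∷ a ∷ []
    ≡⟨ cong (λ zs → a ∷ b ∷ zs) (++-assoc s (reverse s) (b ∷ a ∷ [])) ⟩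
  a ∷ b ∷ s ++ reverse s ++ b ∷ a ∷ []
    ≡⟨ cong (λ zs → a ∷ b ∷ s ++ zs) (reverse-++ (a ∷ b ∷ []) s) ⟨
  a ∷ b ∷ s ++ reverse (a ∷ b ∷ s) ∎
  where
  b = last xs
  us = toList (init xs)
  s = toList (shuffle (init xs))
  toList-xs : toList xs ≡ us ++ [ b ]
  toList-xs = trans (cong toList (sym (init-∷ʳ-last xs))) (toList-∷ʳ b (init xs))

take-shuffle : ∀ {n} (w : Vec A n) i → 2 * i ≤ n →
  take (2 * i) (toList (shuffle w)) ≡ interleave (take i (toList w)) (reverse (drop (n ∸ i) (toList w)))
take-shuffle {n = n} w i 2i≤n = begin
  take (2 * i) s                                ≡⟨ take-++ˡ (2 * i) s (reverse s) 2i≤length ⟨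
  take (2 * i) (s ++ reverse s)                 ≡⟨ cong (take (2 * i)) (interleave-reverse-toList w) ⟨
  take (2 * i) (interleave xs (reverse xs))     ≡⟨ take-interleave i xs (reverse xs) ⟩
  interleave (take i xs) (take i (reverse xs))  ≡⟨ cong (interleave (take i xs)) (take-reverse i xs (length-toList w) i≤n) ⟩
  interleave (take i xs) (reverse (drop (n ∸ i) xs)) ∎
  where
  xs = toList w
  s = toList (shuffle w)
  i≤n : i ≤ n
  i≤n = ≤-trans (m≤m+n i (i + 0)) 2i≤n
  2i≤length : 2 * i ≤ length s
  2i≤length = ≤-trans 2i≤n (≤-reflexive (sym (length-toList (shuffle w))))

border⇔evenPalPrefix-shuffle : ∀ {k n} (w : Vec (Fin k) n) i → 2 * i ≤ n →
  IsBorderLength w i ⇔ HasEvenPalPrefixOfOrder (shuffle w) i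
border⇔evenPalPrefix-shuffle {n = n} w i 2i≤n =
  mk⇔ (λ border → 2i≤n , subst Palindrome (sym prefix) (Equivalence.from palindrome⇔ border))
      (λ (_ , pal) → Equivalence.to palindrome⇔ (subst Palindrome prefix pal))
  where
  xs = toList w
  i≤n : i ≤ n
  i≤n = ≤-trans (m≤m+n i (i + 0)) 2i≤n
  prefix = take-shuffle w i 2i≤n
  same-length : length (take i xs) ≡ length (drop (n ∸ i) xs)
  same-length = trans (length-take i xs) (trans (cong (i ⊓_) (length-toList w))
    (trans (m≤n⇒m⊓n≡m i≤n) (sym (length-drop-∸ i xs (length-toList w) i≤n))))
  palindrome⇔ = palindrome-interleave-reverse (take i xs) (drop (n ∸ i) xs) same-length

length-filter-map : ∀ {P : Pred A 0ℓ} (P? : Decidable P) (f : A → A) xs →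
  length (filter P? (map f xs)) ≡ length (filter (P? ∘ f) xs)
length-filter-map P? f [] = refl
length-filter-map P? f (x ∷ xs) with P? (f x)
... | yes _ = cong suc (length-filter-map P? f xs)
... | no  _ = length-filter-map P? f xs

map-↭ : ∀ {xs : List A} (f g : A → A) → (∀ x → g (f x) ≡ x) → (∀ y → f (g y) ≡ y) →
  Unique xs → (∀ x → x ∈ xs) → map f xs ↭ xs
map-↭ {xs = xs} f g gf fg unique complete = ∼bag⇒↭ (unique∧set⇒bag (Unique.map⁺ f-injective unique) unique
  (λ {y} → mk⇔ (λ _ → complete y) (λ _ → subst (_∈ map f xs) (fg y) (∈-map⁺ f (complete (g y))))))
  where
  f-injective : ∀ {x y} → f x ≡ f y → x ≡ y
  f-injective {x} {y} e = trans (sym (gf x)) (trans (cong g e) (gf y))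

length-filter-bijection : ∀ {P Q : Pred A 0ℓ} (P? : Decidable P) (Q? : Decidable Q) (f g : A → A) →
  (∀ x → g (f x) ≡ x) → (∀ y → f (g y) ≡ y) → (∀ x → P x ⇔ Q (f x)) →
  ∀ {xs} → Unique xs → (∀ x → x ∈ xs) → length (filter P? xs) ≡ length (filter Q? xs)
length-filter-bijection P? Q? f g gf fg P⇔Qf {xs} unique complete = begin
  length (filter P? xs)           ≡⟨ cong length (filter-≐ P? (Q? ∘ f) (Equivalence.to (P⇔Qf _) , Equivalence.from (P⇔Qf _)) xs) ⟩
  length (filter (Q? ∘ f) xs)     ≡⟨ length-filter-map Q? f xs ⟨
  length (filter Q? (map f xs))   ≡⟨ ↭-length (filter-↭ Q? (map-↭ f g gf fg unique complete)) ⟩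
  length (filter Q? xs)           ∎

allWords-suc : ∀ k n → allWords k (suc n) ≡ cartesianProductWith _∷_ (allFin k) (allWords k n)
allWords-suc k n = go (allFin k)
  where
  go : ∀ as → concatMap (λ a → map (a ∷_) (allWords k n)) as ≡ cartesianProductWith _∷_ as (allWords k n)
  go []       = refl
  go (a ∷ as) = cong (map (a ∷_) (allWords k n) ++_) (go as)

allWords-complete : ∀ k n (w : Vec (Fin k) n) → w ∈ allWords k n
allWords-complete k zero    []      = here refl
allWords-complete k (suc n) (a ∷ w) rewrite allWords-suc k n =
  ∈-cartesianProductWith⁺ _∷_ (∈-allFin a) (allWords-complete k n w)

allWords-unique : ∀ k n → Unique (allWords k n)
allWords-unique k zero    = [] ∷ []
allWords-unique k (suc n) rewrite allWords-suc k n =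
  Unique.cartesianProductWith⁺ _∷_ (λ e → ∷-injectiveˡ e , ∷-injectiveʳ e) (Unique.allFin⁺ k) (allWords-unique k n)

2*suc-toℕ≤ : ∀ n (j : Fin (n / 2)) → 2 * suc (toℕ j) ≤ n
2*suc-toℕ≤ n j = ≤-trans (≤-reflexive (*-comm 2 (suc (toℕ j)))) (≤-trans (*-monoˡ-≤ 2 (toℕ<n j)) (m/n*n≤m n 2))

-- The hypotheses k ≥ 1 and n ≥ 1 are not needed: shuffle requires no default letter.
corollary3 : (k n : ℕ) → k ≥ 1 → n ≥ 1 → (S : SubsetHalf n)
             → (d₁ : Decidable (ShortBordersAre {k} {n} S))
             → (d₂ : Decidable (EvenPalOrdersAre {k} {n} S))
             → count k n d₁ ≡ count k n d₂
corollary3 k n _ _ S d₁ d₂ =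
  length-filter-bijection d₁ d₂ shuffle unshuffle unshuffle-shuffle shuffle-unshuffle same-sets
    (allWords-unique k n) (allWords-complete k n)
  where
  border⇔ : ∀ w (j : Fin (n / 2)) →
    IsBorderLength w (suc (toℕ j)) ⇔ HasEvenPalPrefixOfOrder (shuffle w) (suc (toℕ j))
  border⇔ w j = border⇔evenPalPrefix-shuffle w (suc (toℕ j)) (2*suc-toℕ≤ n j)

  same-sets : ∀ w → ShortBordersAre S w ⇔ EvenPalOrdersAre S (shuffle w)
  same-sets w = mk⇔ (λ borders j → borders j ⇔-∘ ⇔-sym (border⇔ w j))
                    (λ palindromes j → palindromes j ⇔-∘ border⇔ w j)
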